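{- Every coloring of the edges of $K_{6,6}$ with $4$ colors contains a monochromatic path on four vertices, while there exists a coloring of the edges of $K_{5,5}$ with $4$ colors containing no monochromatic path on four vertices. Equivalently, $f(4)=6$, where $f(r)$ is the smallest $\ell$ such that every $r$-coloring of the edges of $K_{\ell,\ell}$ contains a monochromatic $P_4$; equivalently, the star arboricity of $K_{5,5}$ equals $4$.
   Context: A star is a tree with at most one vertex of degree greater than one (including isolated vertices and single edges); a star forest is a forest each of whose components is a star. The star arboricity $st(G)$ of a graph $G$ is the minimum number of star forests whose edge sets partition $E(G)$. $P_4$ denotes the path on four vertices. -}

module Defs where

open import Data.Nat using (ℕ)
open import Data.Fin using (Fin)
open import Data.Product using (∃-syntax; _×_)
open import Relation.Binary.PropositionalEquality using (_≡_; _≢_)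

-- An r-colouring of the edges of the complete bipartite graph K_{ℓ,ℓ}:
-- left vertices Fin ℓ, right vertices Fin ℓ, edge {i, j} gets colour c i j.
EdgeColouring : ℕ → ℕ → Set
EdgeColouring ℓ r = Fin ℓ → Fin ℓ → Fin r

-- A path on four vertices in K_{ℓ,ℓ} alternates sides; up to reversal it is
-- a(left) – b(right) – a'(left) – b'(right) with a ≢ a', b ≢ b'.
HasMonoP4 : ∀ {ℓ r} → EdgeColouring ℓ r → Set
HasMonoP4 {ℓ} c =
  ∃[ a ] ∃[ b ] ∃[ a' ] ∃[ b' ]
    (a ≢ a' × b ≢ b' × c a b ≡ c a' b × c a' b ≡ c a' b')

module Submission where

-- In a P₄-free colouring every edge ab is pendant: its colour
-- occurs only once at a or only once at b (two further edges a'b and ab' of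
-- the same colour would form the path a'–b–a–b').  Counting the edges of a
-- colour k through a pendant endpoint gives  E_k ≤ P_k + Q_k,  where P_k
-- (Q_k) is the number of rows (columns) in which k occurs exactly once.  A
-- row of six entries in four colours has at most three singleton colours, so
-- the 36 edges force every row and column to have exactly three singletons.
-- Such a row has colour counts {1,1,1,3}: every colour k satisfies
-- count + 2·[count = 1] = 3 in it.  Summing over rows and over columns gives
-- E_k + 2P_k = 18 = E_k + 2Q_k, hence P_k = Q_k ≥ 5 and E_k ≤ 8, so that
-- 36 = Σ_k E_k ≤ 32, a contradiction.  The profile of a single row is the
-- only finite check (4⁶ rows, by exhaustive enumeration).

open import Defs
open import Data.Nat using (ℕ; zero; suc; _+_; _*_; _≤_; _≤?_; z≤n; s≤s)
  renaming (_≟_ to _≟ℕ_)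
open import Data.Nat.Properties hiding (_≟_)
open import Data.Fin using (Fin; zero; suc; _≟_)
open import Data.Fin.Patterns using (0F; 1F; 2F; 3F)
open import Data.Fin.Properties using (any?; all?) renaming (suc-injective to Fin-suc-injective)
open import Data.Vec using (Vec; []; _∷_; lookup; tabulate)
open import Data.Product using (_×_; ∃-syntax; _,_; proj₁; proj₂)
open import Data.Sum using (_⊎_; inj₁; inj₂; swap)
open import Data.Bool using (if_then_else_)
open import Data.Unit using (tt)
open import Function using (_∘_)
open import Relation.Nullary using (¬_; Dec; yes; no; does)
open import Relation.Nullary.Decidable
  using (¬?; _×-dec_; _→-dec_; map′; toWitness; toWitnessFalse; dec-true; dec-false; decidable-stable)
open import Relation.Binary.PropositionalEquality
open import Algebra.Properties.CommutativeMonoid.Sum +-0-commutativeMonoid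
  using (sum; sum-syntax; sum-cong-≗; ∑-distrib-+; ∑-comm)
open import Algebra.Properties.Semiring.Sum +-*-semiring
  using (*-distribˡ-sum; *-distribʳ-sum)

∑-const : ∀ n m → ∑[ i < n ] m ≡ n * m
∑-const zero    m = refl
∑-const (suc n) m = cong (m +_) (∑-const n m)

∑-mono-≤ : ∀ {n} {f g : Fin n → ℕ} → (∀ i → f i ≤ g i) → sum f ≤ sum g
∑-mono-≤ {zero}  f≤g = z≤n
∑-mono-≤ {suc n} f≤g = +-mono-≤ (f≤g zero) (∑-mono-≤ (f≤g ∘ suc))

∑-saturated : ∀ {n} (f : Fin n → ℕ) m →
  (∀ i → f i ≤ m) → n * m ≤ sum f → ∀ i → f i ≡ m
∑-saturated {suc n} f m f≤m nm≤∑ zero = ≤-antisym (f≤m zero)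
  (+-cancelʳ-≤ (n * m) m (f zero) (begin
    m + n * m                     ≤⟨ nm≤∑ ⟩
    f zero + sum (f ∘ suc)        ≤⟨ +-monoʳ-≤ (f zero) (∑-mono-≤ (f≤m ∘ suc)) ⟩
    f zero + ∑[ i < n ] m         ≡⟨ cong (f zero +_) (∑-const n m) ⟩
    f zero + n * m                ∎))
  where open ≤-Reasoning
∑-saturated {suc n} f m f≤m nm≤∑ (suc i) = ∑-saturated (f ∘ suc) m (f≤m ∘ suc)
  (+-cancelˡ-≤ m _ _ (≤-trans nm≤∑ (+-monoˡ-≤ (sum (f ∘ suc)) (f≤m zero)))) i

∑-weight : ∀ {n} (x y : Fin n → ℕ) w →
  (∀ i → x i + 2 * y i ≡ w) → sum x + 2 * sum y ≡ n * w
∑-weight {n} x y w eq = begin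
  sum x + 2 * sum y                 ≡⟨ cong (sum x +_) (*-distribˡ-sum 2 y) ⟩
  sum x + ∑[ i < n ] (2 * y i)      ≡⟨ sym (∑-distrib-+ x (λ i → 2 * y i)) ⟩
  ∑[ i < n ] (x i + 2 * y i)        ≡⟨ sum-cong-≗ eq ⟩
  ∑[ i < n ] w                      ≡⟨ ∑-const n w ⟩
  n * w                             ∎
  where open ≡-Reasoning

indicator : ∀ {r} → Fin r → Fin r → ℕ
indicator x k = if does (x ≟ k) then 1 else 0

indicator-≡ : ∀ {r} {x k : Fin r} → x ≡ k → indicator x k ≡ 1
indicator-≡ {x = x} {k} x≡k rewrite dec-true (x ≟ k) x≡k = refl

indicator-≢ : ∀ {r} {x k : Fin r} → ¬ x ≡ k → indicator x k ≡ 0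
indicator-≢ {x = x} {k} x≢k rewrite dec-false (x ≟ k) x≢k = refl

∑-indicator : ∀ {r} (x : Fin r) → ∑[ k < r ] indicator x k ≡ 1
∑-indicator {suc r} zero    = cong suc (trans (∑-const r 0) (*-zeroʳ r))
∑-indicator {suc r} (suc x) = ∑-indicator x

count : ∀ {n r} → (Fin n → Fin r) → Fin r → ℕ
count {n} f k = ∑[ j < n ] indicator (f j) k

∑-count : ∀ {n r} (f : Fin n → Fin r) → ∑[ k < r ] count f k ≡ n
∑-count {n} {r} f = begin
  ∑[ k < r ] ∑[ j < n ] indicator (f j) k   ≡⟨ ∑-comm (λ k j → indicator (f j) k) ⟩
  ∑[ j < n ] ∑[ k < r ] indicator (f j) k   ≡⟨ sum-cong-≗ (∑-indicator ∘ f) ⟩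
  ∑[ j < n ] 1                              ≡⟨ ∑-const n 1 ⟩
  n * 1                                     ≡⟨ *-identityʳ n ⟩
  n                                         ∎
  where open ≡-Reasoning

count-absent : ∀ {n r} (f : Fin n → Fin r) k → (∀ j → ¬ f j ≡ k) → count f k ≡ 0
count-absent {zero}  f k absent = refl
count-absent {suc n} f k absent rewrite indicator-≢ (absent zero) =
  count-absent (f ∘ suc) k (absent ∘ suc)

count-unique : ∀ {n r} (f : Fin n → Fin r) b k →
  f b ≡ k → (∀ j → ¬ j ≡ b → ¬ f j ≡ k) → count f k ≡ 1
count-unique f zero k fb≡k others rewrite indicator-≡ fb≡k =
  cong suc (count-absent (f ∘ suc) k (λ j → others (suc j) λ ()))
count-unique f (suc b) k fb≡k others rewrite indicator-≢ (others zero λ ()) =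
  count-unique (f ∘ suc) b k fb≡k (λ j j≢b → others (suc j) (j≢b ∘ Fin-suc-injective))

isOne : ℕ → ℕ
isOne 1 = 1
isOne _ = 0

*-isOne : ∀ m → m * isOne m ≡ isOne m
*-isOne 0             = refl
*-isOne 1             = refl
*-isOne (suc (suc m)) = *-zeroʳ (suc (suc m))

∑-weighted-count : ∀ {n r} (f : Fin n → Fin r) k →
  ∑[ j < n ] (indicator (f j) k * isOne (count f k)) ≡ isOne (count f k)
∑-weighted-count f k =
  trans (sym (*-distribʳ-sum (isOne (count f k)) (λ j → indicator (f j) k)))
        (*-isOne (count f k))

singletons : ∀ {n r} → (Fin n → Fin r) → ℕ
singletons {r = r} f = ∑[ k < r ] isOne (count f k)

-- Colourings of K_ℓ,ℓ.  Rows are the left vertices, columns the right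
-- vertices; transposing exchanges the two sides.

transpose : ∀ {ℓ r} → EdgeColouring ℓ r → EdgeColouring ℓ r
transpose c b a = c a b

edges : ∀ {ℓ r} → EdgeColouring ℓ r → Fin r → ℕ
edges {ℓ} c k = ∑[ a < ℓ ] count (c a) k

singletonRows : ∀ {ℓ r} → EdgeColouring ℓ r → Fin r → ℕ
singletonRows {ℓ} c k = ∑[ a < ℓ ] isOne (count (c a) k)

edges-transpose : ∀ {ℓ r} (c : EdgeColouring ℓ r) k → edges (transpose c) k ≡ edges c k
edges-transpose c k = ∑-comm (λ b a → indicator (c a b) k)

∑-edges : ∀ {ℓ r} (c : EdgeColouring ℓ r) → ∑[ k < r ] edges c k ≡ ℓ * ℓ
∑-edges {ℓ} {r} c = begin
  ∑[ k < r ] ∑[ a < ℓ ] count (c a) k   ≡⟨ ∑-comm (λ k a → count (c a) k) ⟩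
  ∑[ a < ℓ ] ∑[ k < r ] count (c a) k   ≡⟨ sum-cong-≗ (∑-count ∘ c) ⟩
  ∑[ a < ℓ ] ℓ                          ≡⟨ ∑-const ℓ ℓ ⟩
  ℓ * ℓ                                 ∎
  where open ≡-Reasoning

∑-singletonRows : ∀ {ℓ r} (c : EdgeColouring ℓ r) →
  ∑[ k < r ] singletonRows c k ≡ ∑[ a < ℓ ] singletons (c a)
∑-singletonRows c = ∑-comm (λ k a → isOne (count (c a) k))

Pendant : ∀ {ℓ r} → EdgeColouring ℓ r → Set
Pendant c = ∀ a b → count (c a) (c a b) ≡ 1 ⊎ count (transpose c b) (c a b) ≡ 1

pendant-transpose : ∀ {ℓ r} {c : EdgeColouring ℓ r} → Pendant c → Pendant (transpose c)
pendant-transpose pendant b a = swap (pendant a b)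

-- In a P₄-free colouring all edges are pendant: if ab shares its colour with
-- some ab' (b' ≠ b), then no a'b (a' ≠ a) may have it, by the path a'–b–a–b'.
P4-free⇒pendant : ∀ {ℓ r} (c : EdgeColouring ℓ r) → ¬ HasMonoP4 c → Pendant c
P4-free⇒pendant c noP4 a b
  with any? (λ b' → ¬? (b' ≟ b) ×-dec (c a b' ≟ c a b))
... | no noRowTwin =
  inj₁ (count-unique (c a) b _ refl λ b' b'≢b same → noRowTwin (b' , b'≢b , same))
... | yes (b' , b'≢b , rowTwin) =
  inj₂ (count-unique (transpose c b) a _ refl λ a' a'≢a colTwin →
    noP4 (a' , b , a , b' , a'≢a , b'≢b ∘ sym , colTwin , sym rowTwin))

-- A pendant edge of colour k is counted by a row or a column in which k is
-- a singleton.
pendant-edge : ∀ {ℓ r} (c : EdgeColouring ℓ r) → Pendant c → ∀ k a b →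
  indicator (c a b) k ≤
    indicator (c a b) k * isOne (count (c a) k)
      + indicator (c a b) k * isOne (count (transpose c b) k)
pendant-edge c pendant k a b with c a b ≟ k
... | no  _    = z≤n
... | yes refl with pendant a b
...   | inj₁ row≡1 rewrite row≡1 = s≤s z≤n
...   | inj₂ col≡1 rewrite col≡1 = m≤n+m 1 _

pendant⇒edges≤ : ∀ {ℓ r} (c : EdgeColouring ℓ r) → Pendant c → ∀ k →
  edges c k ≤ singletonRows c k + singletonRows (transpose c) k
pendant⇒edges≤ {ℓ} c pendant k = begin
  ∑[ a < ℓ ] ∑[ b < ℓ ] indicator (c a b) k
    ≤⟨ ∑-mono-≤ (λ a → ∑-mono-≤ (pendant-edge c pendant k a)) ⟩
  ∑[ a < ℓ ] ∑[ b < ℓ ] (viaRow a b + viaCol a b)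
    ≡⟨ sum-cong-≗ (λ a → ∑-distrib-+ (viaRow a) (viaCol a)) ⟩
  ∑[ a < ℓ ] (∑[ b < ℓ ] viaRow a b + ∑[ b < ℓ ] viaCol a b)
    ≡⟨ ∑-distrib-+ (λ a → ∑[ b < ℓ ] viaRow a b) (λ a → ∑[ b < ℓ ] viaCol a b) ⟩
  ∑[ a < ℓ ] ∑[ b < ℓ ] viaRow a b + ∑[ a < ℓ ] ∑[ b < ℓ ] viaCol a b
    ≡⟨ cong₂ _+_ (sum-cong-≗ λ a → ∑-weighted-count (c a) k)
                 (trans (∑-comm viaCol) (sum-cong-≗ λ b → ∑-weighted-count (transpose c b) k)) ⟩
  singletonRows c k + singletonRows (transpose c) k
    ∎
  where
  open ≤-Reasoning
  viaRow viaCol : Fin ℓ → Fin ℓ → ℕ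
  viaRow a b = indicator (c a b) k * isOne (count (c a) k)
  viaCol a b = indicator (c a b) k * isOne (count (transpose c b) k)

pendant⇒edge-bound : ∀ {ℓ r} (c : EdgeColouring ℓ r) → Pendant c →
  ℓ * ℓ ≤ ∑[ a < ℓ ] singletons (c a) + ∑[ b < ℓ ] singletons (transpose c b)
pendant⇒edge-bound {ℓ} {r} c pendant = begin
  ℓ * ℓ
    ≡⟨ ∑-edges c ⟨
  ∑[ k < r ] edges c k
    ≤⟨ ∑-mono-≤ (pendant⇒edges≤ c pendant) ⟩
  ∑[ k < r ] (singletonRows c k + singletonRows (transpose c) k)
    ≡⟨ ∑-distrib-+ (singletonRows c) (singletonRows (transpose c)) ⟩
  ∑[ k < r ] singletonRows c k + ∑[ k < r ] singletonRows (transpose c) k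
    ≡⟨ cong₂ _+_ (∑-singletonRows c) (∑-singletonRows (transpose c)) ⟩
  ∑[ a < ℓ ] singletons (c a) + ∑[ b < ℓ ] singletons (transpose c b)
    ∎
  where open ≤-Reasoning

∀-word? : ∀ {n r} {P : Vec (Fin r) n → Set} → (∀ v → Dec (P v)) → Dec (∀ v → P v)
∀-word? {zero}  P? = map′ (λ p → λ { [] → p }) (λ all → all []) (P? [])
∀-word? {suc n} P? = map′ (λ all → λ { (x ∷ v) → all x v }) (λ all x v → all (x ∷ v))
  (all? λ x → ∀-word? λ v → P? (x ∷ v))

RowProfile : (Fin 6 → Fin 4) → Set
RowProfile f = singletons f ≤ 3
  × (singletons f ≡ 3 → ∀ k → count f k + 2 * isOne (count f k) ≡ 3)

row-profile : ∀ f → RowProfile f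
row-profile f = toWitness {a? = ∀-word? (rowProfile? ∘ lookup)} tt (tabulate f)
  where
  rowProfile? : ∀ g → Dec (RowProfile g)
  rowProfile? g = (singletons g ≤? 3) ×-dec
    (singletons g ≟ℕ 3 →-dec all? λ k → count g k + 2 * isOne (count g k) ≟ℕ 3)

-- With all 36 edges pendant, every row has exactly three singletons: the
-- columns contribute at most 6·3 singletons, so the rows need 6·3 more.
pendant⇒rows-saturated : ∀ (c : EdgeColouring 6 4) → Pendant c → ∀ a → singletons (c a) ≡ 3
pendant⇒rows-saturated c pendant = ∑-saturated (singletons ∘ c) 3 (proj₁ ∘ row-profile ∘ c)
  (+-cancelʳ-≤ 18 18 (∑[ a < 6 ] singletons (c a)) (begin
    36                                                            ≤⟨ pendant⇒edge-bound c pendant ⟩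
    ∑[ a < 6 ] singletons (c a) + ∑[ b < 6 ] singletons (transpose c b)
      ≤⟨ +-monoʳ-≤ _ (∑-mono-≤ (proj₁ ∘ row-profile ∘ transpose c)) ⟩
    ∑[ a < 6 ] singletons (c a) + 18                              ∎))
  where open ≤-Reasoning

saturated⇒weight : ∀ (c : EdgeColouring 6 4) → (∀ a → singletons (c a) ≡ 3) →
  ∀ k → edges c k + 2 * singletonRows c k ≡ 18
saturated⇒weight c saturated k =
  ∑-weight (λ a → count (c a) k) (λ a → isOne (count (c a) k)) 3
    (λ a → proj₂ (row-profile (c a)) (saturated a) k)

-- From E ≤ P + Q and E + 2P = 18 = E + 2Q: P = Q, so 18 ≤ 4P, P ≥ 5, E ≤ 8.
colour-bound : ∀ e p q → e ≤ p + q → e + 2 * p ≡ 18 → e + 2 * q ≡ 18 → e ≤ 8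
colour-bound e p q e≤p+q e+2p≡18 e+2q≡18 = +-cancelʳ-≤ 10 e 8 (begin
  e + 10      ≤⟨ +-monoʳ-≤ e (*-monoʳ-≤ 2 5≤p) ⟩
  e + 2 * p   ≡⟨ e+2p≡18 ⟩
  18          ∎)
  where
  open ≤-Reasoning
  p≡q : p ≡ q
  p≡q = *-cancelˡ-≡ p q 2 (+-cancelˡ-≡ e _ _ (trans e+2p≡18 (sym e+2q≡18)))
  e≤2p : e ≤ 2 * p
  e≤2p = begin
    e           ≤⟨ e≤p+q ⟩
    p + q       ≡⟨ cong (p +_) (trans (+-identityʳ p) p≡q) ⟨
    2 * p       ∎
  5≤p : 5 ≤ p
  5≤p = ≰⇒> λ p≤4 → <⇒≱ (≤ᵇ⇒≤ 17 18 tt) (begin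
    18              ≡⟨ e+2p≡18 ⟨
    e + 2 * p       ≤⟨ +-monoˡ-≤ (2 * p) e≤2p ⟩
    2 * p + 2 * p   ≡⟨ *-distribʳ-+ p 2 2 ⟨
    4 * p           ≤⟨ *-monoʳ-≤ 4 p≤4 ⟩
    16              ∎)

-- No 4-colouring of K₆,₆ has all edges pendant: each colour has at most
-- 8 edges, but there are 36 > 4·8 edges.
no-pendant-colouring : ∀ (c : EdgeColouring 6 4) → ¬ Pendant c
no-pendant-colouring c pendant = <⇒≱ (≤ᵇ⇒≤ 33 36 tt) (begin
  36                   ≡⟨ ∑-edges c ⟨
  ∑[ k < 4 ] edges c k ≤⟨ ∑-mono-≤ colourClass≤8 ⟩
  ∑[ k < 4 ] 8         ∎)
  where
  open ≤-Reasoning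
  pendant-columns : Pendant (transpose c)
  pendant-columns = pendant-transpose {c = c} pendant
  colourClass≤8 : ∀ k → edges c k ≤ 8
  colourClass≤8 k = colour-bound (edges c k) (singletonRows c k) (singletonRows (transpose c) k)
    (pendant⇒edges≤ c pendant k)
    (saturated⇒weight c (pendant⇒rows-saturated c pendant) k)
    (begin-equality
      edges c k + 2 * singletonRows (transpose c) k
        ≡⟨ cong (_+ 2 * singletonRows (transpose c) k) (edges-transpose c k) ⟨
      edges (transpose c) k + 2 * singletonRows (transpose c) k
        ≡⟨ saturated⇒weight (transpose c) (pendant⇒rows-saturated (transpose c) pendant-columns) k ⟩
      18 ∎)

monoP4? : ∀ {ℓ r} (c : EdgeColouring ℓ r) → Dec (HasMonoP4 c)
monoP4? c = any? λ a → any? λ b → any? λ a' → any? λ b' →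
  ¬? (a ≟ a') ×-dec ¬? (b ≟ b') ×-dec (c a b ≟ c a' b) ×-dec (c a' b ≟ c a' b')

-- Lower bound: since a monochromatic P₄ is decidable, it suffices that its
-- absence is contradictory, and a P₄-free colouring would have all edges
-- pendant.
K66-monoP4 : (c : EdgeColouring 6 4) → HasMonoP4 c
K66-monoP4 c = decidable-stable (monoP4? c) λ noP4 →
  no-pendant-colouring c (P4-free⇒pendant c noP4)

-- Upper bound: a P₄-free 4-colouring of K₅,₅; row a lists the colours of
-- the edges at the left vertex a.
K55-table : Vec (Vec (Fin 4) 5) 5
K55-table =
  (0F ∷ 0F ∷ 0F ∷ 1F ∷ 1F ∷ []) ∷
  (1F ∷ 2F ∷ 3F ∷ 0F ∷ 2F ∷ []) ∷
  (1F ∷ 3F ∷ 2F ∷ 0F ∷ 3F ∷ []) ∷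
  (2F ∷ 1F ∷ 3F ∷ 2F ∷ 0F ∷ []) ∷
  (3F ∷ 1F ∷ 2F ∷ 3F ∷ 0F ∷ []) ∷ []

K55-colouring : EdgeColouring 5 4
K55-colouring a b = lookup (lookup K55-table a) b

K55-P4-free : ¬ HasMonoP4 K55-colouring
K55-P4-free = toWitnessFalse {a? = monoP4? K55-colouring} tt

proposition2 : ((c : EdgeColouring 6 4) → HasMonoP4 c)
    × (∃[ c ] ¬ HasMonoP4 {5} {4} c)
proposition2 = K66-monoP4 , (K55-colouring , K55-P4-free)
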